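{- Let $X,Y,Z$ be finite simple graphs, and let the cells, the minimum dominating set $D$ of $X\square Y\square Z$, and the cell coloring be as described in the context. Then \[ b'+r'\leq b+g+y+o. \]
   Context: Graphs are finite and simple; $\gamma(G)$ is the domination number; $X\square Y$ is the Cartesian product (vertex set $V(X)\times V(Y)$, $(x_1,y_1)\sim(x_2,y_2)$ iff $x_1=x_2$ and $y_1y_2\in E(Y)$, or $y_1=y_2$ and $x_1x_2\in E(X)$). Let $k=\gamma(X)$, let $\{u_1,\dots,u_k\}$ be a minimum dominating set of $X$, and let $\{\pi_1,\dots,\pi_k\}$ be a partition of $V(X)$ with $u_i\in\pi_i\subseteq N[u_i]$ for each $i$, where $N[x]$ is the closed neighborhood of $x$ in $X$. For $i\in\{1,\dots,k\}$, $y\in V(Y)$, $z\in V(Z)$, the cell $\pi_i^{y,z}=\{(a,y,z): a\in\pi_i\}\subseteq V(X\square Y\square Z)$; the cells partition $V(X\square Y\square Z)$. Let $D$ be a minimum dominating set of $X\square Y\square Z$. A vertex $(a,b,c)$ is $X$-dominated if some $(a',b,c)\in D$ with $a'=a$ or $a'a\in E(X)$; $Y$-dominated if some $(a,b',c)\in D$ with $b'b\in E(Y)$; $Z$-dominated if some $(a,b,c')\in D$ with $c'c\in E(Z)$. Cells containing a vertex of $D$ are colored: blue if no vertex of the cell is $Y$-dominated or $Z$-dominated; otherwise green if no vertex is $Z$-dominated; otherwise yellow if no vertex is $Y$-dominated; otherwise orange. Cells containing no vertex of $D$ are colored: red if no vertex is $Y$-dominated or $Z$-dominated; otherwise pink if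 no vertex is $Z$-dominated; otherwise maroon if no vertex is $Y$-dominated; otherwise white. Let $b'$ and $r'$ be the total numbers of blue and red cells respectively. Each vertex of $D$ receives the color of the cell containing it; let $b,g,y,o$ be the numbers of vertices of $D$ lying in blue, green, yellow, orange cells respectively (so $b+g+y+o=|D|$). -}

module Defs where

open import Data.Nat using (ℕ; zero; suc; _+_; _*_; _≤_)
open import Data.Bool using (Bool; true; false; _∧_; _∨_; not; if_then_else_)
open import Data.Fin using (Fin; zero; suc; combine; remQuot; _≟_)
open import Data.Fin.Subset using (Subset; _∈_; ∣_∣)
open import Data.Vec using (tabulate; lookup)
open import Data.Product using (_×_; _,_; ∃; Σ)
open import Data.Sum using (_⊎_)
open import Relation.Nullary.Decidable using (⌊_⌋)
open import Relation.Binary.PropositionalEquality using (_≡_)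
open import Function.Definitions using (Injective)

record Graph : Set where
  constructor mkGraph
  field
    n   : ℕ
    adj : Fin n → Fin n → Bool
open Graph public

V : Graph → Set
V G = Fin (n G)

record IsSimple (G : Graph) : Set where
  field
    sym    : ∀ u v → adj G u v ≡ adj G v u
    irrefl : ∀ v → adj G v v ≡ false

anyFin : ∀ {m} → (Fin m → Bool) → Bool
anyFin {zero}  f = false
anyFin {suc m} f = f zero ∨ anyFin (λ i → f (suc i))

count : ∀ {m} → (Fin m → Bool) → ℕ
count {zero}  f = 0
count {suc m} f = (if f zero then 1 else 0) + count (λ i → f (suc i))

sumFin : ∀ {m} → (Fin m → ℕ) → ℕ
sumFin {zero}  f = 0
sumFin {suc m} f = f zero + sumFin (λ i → f (suc i))

eqb : ∀ {m} → Fin m → Fin m → Bool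
eqb i j = ⌊ i ≟ j ⌋

Dominating : (G : Graph) → Subset (n G) → Set
Dominating G S = ∀ v → v ∈ S ⊎ ∃ λ w → w ∈ S × adj G w v ≡ true

IsMinimumDominatingSet : (G : Graph) → Subset (n G) → Set
IsMinimumDominatingSet G S =
  Dominating G S × (∀ T → Dominating G T → ∣ S ∣ ≤ ∣ T ∣)

image : ∀ {k m} → (Fin k → Fin m) → Subset m
image u = tabulate (λ a → anyFin (λ i → eqb (u i) a))

-- Cartesian product of graphs. Vertex (x , y) is encoded as combine x y
-- (decoded by remQuot).

_□_ : Graph → Graph → Graph
X □ Y = mkGraph (n X * n Y) adj□
  where
  adj□ : Fin (n X * n Y) → Fin (n X * n Y) → Bool
  adj□ u v with remQuot (n Y) u | remQuot (n Y) v
  ... | (x₁ , y₁) | (x₂ , y₂) =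
    (eqb x₁ x₂ ∧ adj Y y₁ y₂) ∨ (eqb y₁ y₂ ∧ adj X x₁ x₂)

infixl 6 _□_

-- Cells and their colouring, for X □ Y □ Z = (X □ Y) □ Z,
-- partition p : V X → Fin k (π_i = p⁻¹(i)), and D ⊆ V(X □ Y □ Z).

module Cells (X Y Z : Graph) {k : ℕ} (p : V X → Fin k)
             (D : Subset (n X * n Y * n Z)) where

  vtx : V X → V Y → V Z → Fin (n X * n Y * n Z)
  vtx a b c = combine (combine a b) c

  inD : V X → V Y → V Z → Bool
  inD a b c = lookup D (vtx a b c)

  -- (a,b,c) is Y-dominated / Z-dominated (X-domination is not needed
  -- for the colouring)
  Ydom : V X → V Y → V Z → Bool
  Ydom a b c = anyFin (λ b' → adj Y b' b ∧ inD a b' c)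

  Zdom : V X → V Y → V Z → Bool
  Zdom a b c = anyFin (λ c' → adj Z c' c ∧ inD a b c')

  inCell : Fin k → V X → Bool
  inCell i a = eqb (p a) i

  hasD : Fin k → V Y → V Z → Bool
  hasD i y z = anyFin (λ a → inCell i a ∧ inD a y z)

  hasY : Fin k → V Y → V Z → Bool
  hasY i y z = anyFin (λ a → inCell i a ∧ Ydom a y z)

  hasZ : Fin k → V Y → V Z → Bool
  hasZ i y z = anyFin (λ a → inCell i a ∧ Zdom a y z)

  blue green yellow orange red : Fin k → V Y → V Z → Bool
  blue   i y z = hasD i y z ∧ not (hasY i y z) ∧ not (hasZ i y z)
  green  i y z = hasD i y z ∧ hasY i y z ∧ not (hasZ i y z)
  yellow i y z = hasD i y z ∧ not (hasY i y z) ∧ hasZ i y z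
  orange i y z = hasD i y z ∧ hasY i y z ∧ hasZ i y z
  red    i y z = not (hasD i y z) ∧ not (hasY i y z) ∧ not (hasZ i y z)

  cellCount : (Fin k → V Y → V Z → Bool) → ℕ
  cellCount col = sumFin (λ i → sumFin (λ y → count (λ z → col i y z)))

  vertexCount : (Fin k → V Y → V Z → Bool) → ℕ
  vertexCount col =
    sumFin (λ a → sumFin (λ y → count (λ z → inD a y z ∧ col (p a) y z)))

  b′ r′ bD gD yD oD : ℕ
  b′ = cellCount blue
  r′ = cellCount red
  bD = vertexCount blue
  gD = vertexCount green
  yD = vertexCount yellow
  oD = vertexCount orange

-- Fix a layer (y, z) and call a cell π_i^{y,z} bare when none of its vertices is Y- or
-- Z-dominated; the blue and red cells are exactly the bare ones.  Every vertex of a bare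
-- cell is then dominated inside the X-fibre {(a, y, z)}, so the X-vertices of D in that
-- fibre together with the centres u_i of the non-bare cells dominate X.  Minimality of
-- {u_1, …, u_k} gives k ≤ |D ∩ fibre| + (k − #bare), i.e. #bare ≤ |D ∩ fibre|.  Summing
-- over all layers gives b′ + r′ ≤ |D|, and |D| = b + g + y + o since every vertex of D
-- lies in a coloured cell.
module Submission where

open import Defs
open import Data.Nat using (ℕ; zero; suc; _+_; _*_; _≤_; z≤n; s≤s)
open import Data.Nat.Properties
  using (+-suc; +-mono-≤; +-cancelʳ-≤; ≤-refl; +-commutativeSemigroup; module ≤-Reasoning)
open import Algebra.Properties.CommutativeSemigroup +-commutativeSemigroup using (interchange)
open import Data.Bool using (Bool; true; false; _∧_; _∨_; not; if_then_else_)
open import Data.Bool.Properties using (∨-zeroʳ; ∧-zeroʳ)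
open import Data.Fin using (Fin; zero; suc; combine; _≟_)
open import Data.Fin.Properties using (suc-injective; 0≢1+n; remQuot-combine; combine-injective; combine-surjective)
open import Data.Fin.Subset using (Subset; _∈_; ∣_∣)
open import Data.Vec using (tabulate)
open import Data.Vec.Properties using ([]=⇒lookup; lookup⇒[]=; lookup∘tabulate)
open import Data.Product using (_×_; _,_; ∃; proj₁; proj₂)
open import Data.Sum using (_⊎_; inj₁; inj₂)
open import Relation.Nullary using (¬_; yes; no; contradiction)
open import Relation.Binary.PropositionalEquality
open import Function.Definitions using (Injective)

ind : Bool → ℕ
ind b = if b then 1 else 0

∧-true⁻ : ∀ {a b} → a ∧ b ≡ true → a ≡ true × b ≡ true
∧-true⁻ {true} e = refl , e

∨-true⁻ : ∀ {a b} → a ∨ b ≡ true → a ≡ true ⊎ b ≡ true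
∨-true⁻ {true}  _ = inj₁ refl
∨-true⁻ {false} e = inj₂ e

true≢false : ¬ true ≡ false
true≢false ()

eqb-refl : ∀ {m} (x : Fin m) → eqb x x ≡ true
eqb-refl x with x ≟ x
... | yes _   = refl
... | no  x≢x = contradiction refl x≢x

eqb-false : ∀ {m} {x y : Fin m} → ¬ x ≡ y → eqb x y ≡ false
eqb-false {x = x} {y} x≢y with x ≟ y
... | yes x≡y = contradiction x≡y x≢y
... | no  _   = refl

eqb⇒≡ : ∀ {m} {x y : Fin m} → eqb x y ≡ true → x ≡ y
eqb⇒≡ {x = x} {y} e with x ≟ y
... | yes x≡y = x≡y

eqb-suc : ∀ {m} (x y : Fin m) → eqb (Fin.suc x) (suc y) ≡ eqb x y
eqb-suc x y with x ≟ y
... | yes _ = refl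
... | no  _ = refl

anyFin-intro : ∀ {m} (f : Fin m → Bool) i → f i ≡ true → anyFin f ≡ true
anyFin-intro f zero    fi = cong (_∨ anyFin (λ j → f (suc j))) fi
anyFin-intro f (suc i) fi =
  trans (cong (f zero ∨_) (anyFin-intro (λ j → f (suc j)) i fi)) (∨-zeroʳ (f zero))

anyFin-false : ∀ {m} (f : Fin m → Bool) → (∀ i → f i ≡ false) → anyFin f ≡ false
anyFin-false {zero}  f none = refl
anyFin-false {suc m} f none rewrite none zero = anyFin-false (λ j → f (suc j)) (λ j → none (suc j))

anyFin-false⁻ : ∀ {m} (f : Fin m → Bool) → anyFin f ≡ false → ∀ i → f i ≡ false
anyFin-false⁻ f none i with f i in fi
... | false = refl
... | true  = contradiction (trans (sym (anyFin-intro f i fi)) none) true≢false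

sumFin-cong : ∀ {m} (f g : Fin m → ℕ) → (∀ i → f i ≡ g i) → sumFin f ≡ sumFin g
sumFin-cong {zero}  f g f≡g = refl
sumFin-cong {suc m} f g f≡g = cong₂ _+_ (f≡g zero) (sumFin-cong _ _ (λ i → f≡g (suc i)))

sumFin-mono : ∀ {m} (f g : Fin m → ℕ) → (∀ i → f i ≤ g i) → sumFin f ≤ sumFin g
sumFin-mono {zero}  f g f≤g = z≤n
sumFin-mono {suc m} f g f≤g = +-mono-≤ (f≤g zero) (sumFin-mono _ _ (λ i → f≤g (suc i)))

sumFin-+ : ∀ {m} (f g : Fin m → ℕ) → sumFin f + sumFin g ≡ sumFin (λ i → f i + g i)
sumFin-+ {zero}  f g = refl
sumFin-+ {suc m} f g =
  trans (interchange (f zero) (sumFin (λ i → f (suc i))) (g zero) (sumFin (λ i → g (suc i))))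
        (cong (f zero + g zero +_) (sumFin-+ (λ i → f (suc i)) (λ i → g (suc i))))

sumFin-zero : ∀ m → sumFin {m} (λ _ → 0) ≡ 0
sumFin-zero zero    = refl
sumFin-zero (suc m) = sumFin-zero m

sumFin-swap : ∀ {m l} (f : Fin m → Fin l → ℕ) →
  sumFin (λ i → sumFin (λ j → f i j)) ≡ sumFin (λ j → sumFin (λ i → f i j))
sumFin-swap {zero}  {l} f = sym (sumFin-zero l)
sumFin-swap {suc m}     f =
  trans (cong (sumFin (f zero) +_) (sumFin-swap (λ i → f (suc i))))
        (sumFin-+ (f zero) (λ j → sumFin (λ i → f (suc i) j)))

count-as-sumFin : ∀ {m} (f : Fin m → Bool) → count f ≡ sumFin (λ i → ind (f i))
count-as-sumFin {zero}  f = refl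
count-as-sumFin {suc m} f = cong (ind (f zero) +_) (count-as-sumFin (λ i → f (suc i)))

count-cong : ∀ {m} (f g : Fin m → Bool) → (∀ i → f i ≡ g i) → count f ≡ count g
count-cong {zero}  f g f≡g = refl
count-cong {suc m} f g f≡g =
  cong₂ (λ b c → ind b + c) (f≡g zero) (count-cong _ _ (λ i → f≡g (suc i)))

ind-∨ : ∀ a b → ind (a ∨ b) ≤ ind a + ind b
ind-∨ true  b = s≤s z≤n
ind-∨ false b = ≤-refl

count-∨ : ∀ {m} (f g : Fin m → Bool) → count (λ i → f i ∨ g i) ≤ count f + count g
count-∨ f g = begin
  count (λ i → f i ∨ g i)
    ≡⟨ count-as-sumFin (λ i → f i ∨ g i) ⟩
  sumFin (λ i → ind (f i ∨ g i))
    ≤⟨ sumFin-mono _ _ (λ i → ind-∨ (f i) (g i)) ⟩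
  sumFin (λ i → ind (f i) + ind (g i))
    ≡⟨ sumFin-+ (λ i → ind (f i)) (λ i → ind (g i)) ⟨
  sumFin (λ i → ind (f i)) + sumFin (λ i → ind (g i))
    ≡⟨ cong₂ _+_ (count-as-sumFin f) (count-as-sumFin g) ⟨
  count f + count g ∎
  where open ≤-Reasoning

count-not : ∀ {m} (f : Fin m → Bool) → count f + count (λ i → not (f i)) ≡ m
count-not {zero}  f = refl
count-not {suc m} f with f zero
... | true  = cong suc (count-not (λ i → f (suc i)))
... | false = trans (+-suc (count (λ i → f (suc i))) _) (cong suc (count-not (λ i → f (suc i))))

∣tabulate∣ : ∀ {m} (f : Fin m → Bool) → ∣ tabulate f ∣ ≡ count f
∣tabulate∣ {zero}  f = refl
∣tabulate∣ {suc m} f with f zero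
... | true  = cong suc (∣tabulate∣ (λ i → f (suc i)))
... | false = ∣tabulate∣ (λ i → f (suc i))

∈-tabulate⁺ : ∀ {m} (f : Fin m → Bool) {a} → f a ≡ true → a ∈ tabulate f
∈-tabulate⁺ f {a} fa = lookup⇒[]= a (tabulate f) (trans (lookup∘tabulate f a) fa)

count-insert : ∀ {m} (c : Fin m) (b : Bool) (h : Fin m → Bool) → h c ≡ false →
  count (λ a → (b ∧ eqb c a) ∨ h a) ≡ ind b + count h
count-insert c       false h hc = refl
count-insert zero    true  h hc rewrite hc = refl
count-insert (suc c) true  h hc = trans (cong (ind (h zero) +_) (begin
  count (λ i → eqb (suc c) (suc i) ∨ h (suc i)) ≡⟨ count-cong _ _ (λ i → cong (_∨ h (suc i)) (eqb-suc c i)) ⟩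
  count (λ i → eqb c i ∨ h (suc i))             ≡⟨ count-insert c true (λ i → h (suc i)) hc ⟩
  suc (count (λ i → h (suc i)))                 ∎)) (+-suc (ind (h zero)) _)
  where open ≡-Reasoning

count-image : ∀ {k m} (u : Fin k → Fin m) → Injective _≡_ _≡_ u → (P : Fin k → Bool) →
  count (λ a → anyFin (λ i → P i ∧ eqb (u i) a)) ≡ count P
count-image {zero}  {m} u u-inj P = trans (count-as-sumFin {m} (λ _ → false)) (sumFin-zero m)
count-image {suc k}     u u-inj P = begin
  count (λ a → (P zero ∧ eqb (u zero) a) ∨ image-of-rest a)
    ≡⟨ count-insert (u zero) (P zero) image-of-rest (anyFin-false _ u-zero-not-in-rest) ⟩
  ind (P zero) + count image-of-rest
    ≡⟨ cong (ind (P zero) +_) (count-image (λ i → u (suc i)) (λ e → suc-injective (u-inj e)) (λ i → P (suc i))) ⟩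
  ind (P zero) + count (λ i → P (suc i)) ∎
  where
  open ≡-Reasoning
  image-of-rest : Fin _ → Bool
  image-of-rest a = anyFin (λ i → P (suc i) ∧ eqb (u (suc i)) a)
  u-zero-not-in-rest : ∀ i → (P (suc i) ∧ eqb (u (suc i)) (u zero)) ≡ false
  u-zero-not-in-rest i =
    trans (cong (P (suc i) ∧_) (eqb-false (λ e → 0≢1+n (sym (u-inj e))))) (∧-zeroʳ (P (suc i)))

∣image∣ : ∀ {k m} (u : Fin k → Fin m) → Injective _≡_ _≡_ u → ∣ image u ∣ ≡ k
∣image∣ {k} u u-inj =
  trans (∣tabulate∣ (λ a → anyFin (λ i → eqb (u i) a))) (trans (count-image u u-inj (λ _ → true)) (count-true k))
  where
  count-true : ∀ k → count {k} (λ _ → true) ≡ k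
  count-true zero    = refl
  count-true (suc k) = cong suc (count-true k)

sumFin³ : ∀ {l m r} → (Fin l → Fin m → Fin r → ℕ) → ℕ
sumFin³ f = sumFin (λ a → sumFin (λ b → sumFin (λ c → f a b c)))

count³ : ∀ {l m r} → (Fin l → Fin m → Fin r → Bool) → ℕ
count³ f = sumFin (λ a → sumFin (λ b → count (λ c → f a b c)))

sumFin³-cong : ∀ {l m r} (f g : Fin l → Fin m → Fin r → ℕ) →
  (∀ a b c → f a b c ≡ g a b c) → sumFin³ f ≡ sumFin³ g
sumFin³-cong f g f≡g =
  sumFin-cong _ _ (λ a → sumFin-cong _ _ (λ b → sumFin-cong _ _ (λ c → f≡g a b c)))

sumFin³-+ : ∀ {l m r} (f g : Fin l → Fin m → Fin r → ℕ) →
  sumFin³ f + sumFin³ g ≡ sumFin³ (λ a b c → f a b c + g a b c)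
sumFin³-+ f g =
  trans (sumFin-+ (λ a → sumFin (λ b → sumFin (f a b))) (λ a → sumFin (λ b → sumFin (g a b))))
        (sumFin-cong _ _ (λ a →
          trans (sumFin-+ (λ b → sumFin (f a b)) (λ b → sumFin (g a b)))
                (sumFin-cong _ _ (λ b → sumFin-+ (f a b) (g a b)))))

sumFin³-rotate : ∀ {l m r} (f : Fin l → Fin m → Fin r → ℕ) →
  sumFin³ f ≡ sumFin (λ b → sumFin (λ c → sumFin (λ a → f a b c)))
sumFin³-rotate f = trans (sumFin-swap (λ a b → sumFin (f a b)))
  (sumFin-cong _ _ (λ b → sumFin-swap (λ a c → f a b c)))

count³-as-sumFin³ : ∀ {l m r} (f : Fin l → Fin m → Fin r → Bool) →
  count³ f ≡ sumFin³ (λ a b c → ind (f a b c))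
count³-as-sumFin³ f = sumFin-cong _ _ (λ a → sumFin-cong _ _ (λ b → count-as-sumFin (f a b)))

adj-□-combine : (X Y : Graph) (x₁ x₂ : V X) (y₁ y₂ : V Y) →
  adj (X □ Y) (combine x₁ y₁) (combine x₂ y₂) ≡ (eqb x₁ x₂ ∧ adj Y y₁ y₂) ∨ (eqb y₁ y₂ ∧ adj X x₁ x₂)
adj-□-combine X Y x₁ x₂ y₁ y₂ =
  cong₂ (λ (v w : V X × V Y) → (eqb (proj₁ v) (proj₁ w) ∧ adj Y (proj₂ v) (proj₂ w))
                              ∨ (eqb (proj₂ v) (proj₂ w) ∧ adj X (proj₁ v) (proj₁ w)))
        (remQuot-combine {n X} {n Y} x₁ y₁) (remQuot-combine {n X} {n Y} x₂ y₂)

□-adj⁻ : (X Y : Graph) {x₁ x₂ : V X} {y₁ y₂ : V Y} →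
  adj (X □ Y) (combine x₁ y₁) (combine x₂ y₂) ≡ true →
  (x₁ ≡ x₂ × adj Y y₁ y₂ ≡ true) ⊎ (y₁ ≡ y₂ × adj X x₁ x₂ ≡ true)
□-adj⁻ X Y {x₁} {x₂} {y₁} {y₂} e with ∨-true⁻ (trans (sym (adj-□-combine X Y x₁ x₂ y₁ y₂)) e)
... | inj₁ e₁ = let x₁≡x₂ , y₁~y₂ = ∧-true⁻ e₁ in inj₁ (eqb⇒≡ x₁≡x₂ , y₁~y₂)
... | inj₂ e₂ = let y₁≡y₂ , x₁~x₂ = ∧-true⁻ e₂ in inj₂ (eqb⇒≡ y₁≡y₂ , x₁~x₂)

□³-adj⁻ : (X Y Z : Graph) {a a′ : V X} {b b′ : V Y} {c c′ : V Z} →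
  adj (X □ Y □ Z) (combine (combine a′ b′) c′) (combine (combine a b) c) ≡ true →
  (a′ ≡ a × b′ ≡ b × adj Z c′ c ≡ true) ⊎
  (a′ ≡ a × c′ ≡ c × adj Y b′ b ≡ true) ⊎
  (b′ ≡ b × c′ ≡ c × adj X a′ a ≡ true)
□³-adj⁻ X Y Z {a} {a′} {b} {b′} e with □-adj⁻ (X □ Y) Z e
... | inj₁ (ab≡ , c′~c) = let a′≡a , b′≡b = combine-injective a′ b′ a b ab≡ in inj₁ (a′≡a , b′≡b , c′~c)
... | inj₂ (c′≡c , ab~) with □-adj⁻ X Y ab~
...   | inj₁ (a′≡a , b′~b) = inj₂ (inj₁ (a′≡a , c′≡c , b′~b))
...   | inj₂ (b′≡b , a′~a) = inj₂ (inj₂ (b′≡b , c′≡c , a′~a))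

not-true⁻ : ∀ {b} → not b ≡ true → b ≡ false
not-true⁻ {false} _ = refl

ind-split : ∀ a b → ind (a ∧ b) + ind (not a ∧ b) ≡ ind b
ind-split true  true  = refl
ind-split true  false = refl
ind-split false b     = refl

ind-split⁴ : ∀ e d s t → (e ≡ true → d ≡ true) →
  ind (e ∧ d ∧ not s ∧ not t) + ind (e ∧ d ∧ s ∧ not t)
    + ind (e ∧ d ∧ not s ∧ t) + ind (e ∧ d ∧ s ∧ t) ≡ ind e
ind-split⁴ false d s t _ = refl
ind-split⁴ true  d s t e⇒d with e⇒d refl
... | refl with s | t
...   | true  | true  = refl
...   | true  | false = refl
...   | false | true  = refl
...   | false | false = refl

module _ (X Y Z : Graph) {k : ℕ} (p : V X → Fin k) (D : Subset (n (X □ Y □ Z))) where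
  open Cells X Y Z p D

  bare : Fin k → V Y → V Z → Bool
  bare i y z = not (hasY i y z) ∧ not (hasZ i y z)

  bare⇒undominated : ∀ {a y z} → bare (p a) y z ≡ true → Ydom a y z ≡ false × Zdom a y z ≡ false
  bare⇒undominated {a} bare-pa =
    let noY , noZ = ∧-true⁻ bare-pa in cell-none Ydom (not-true⁻ noY) , cell-none Zdom (not-true⁻ noZ)
    where
    cell-none : ∀ {y z} (P : V X → V Y → V Z → Bool) →
      anyFin (λ a′ → inCell (p a) a′ ∧ P a′ y z) ≡ false → P a y z ≡ false
    cell-none {y} {z} P none =
      trans (cong (_∧ P a y z) (sym (eqb-refl (p a)))) (anyFin-false⁻ _ none a)

  fibre-dominated : Dominating (X □ Y □ Z) D → ∀ {a y z} →
    Ydom a y z ≡ false → Zdom a y z ≡ false →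
    inD a y z ≡ true ⊎ ∃ λ a′ → inD a′ y z ≡ true × adj X a′ a ≡ true
  fibre-dominated dom {a} {y} {z} noY noZ with dom (vtx a y z)
  ... | inj₁ a∈D = inj₁ ([]=⇒lookup a∈D)
  ... | inj₂ (w , w∈D , w~a) with combine-surjective {n X * n Y} {n Z} w
  ... | ab′ , c′ , refl with combine-surjective {n X} {n Y} ab′
  ... | a′ , b′ , refl with □³-adj⁻ X Y Z w~a
  ... | inj₁ (refl , refl , c′~z) =
    contradiction (trans (sym (anyFin-intro (λ c → adj Z c z ∧ inD a y c) c′
                                 (cong₂ _∧_ c′~z ([]=⇒lookup w∈D)))) noZ) true≢false
  ... | inj₂ (inj₁ (refl , refl , b′~y)) =
    contradiction (trans (sym (anyFin-intro (λ b → adj Y b y ∧ inD a b z) b′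
                                 (cong₂ _∧_ b′~y ([]=⇒lookup w∈D)))) noY) true≢false
  ... | inj₂ (inj₂ (refl , refl , a′~a)) = inj₂ (a′ , []=⇒lookup w∈D , a′~a)

  blue+red≡bare : b′ + r′ ≡ sumFin³ (λ i y z → ind (bare i y z))
  blue+red≡bare = begin
    count³ blue + count³ red
      ≡⟨ cong₂ _+_ (count³-as-sumFin³ blue) (count³-as-sumFin³ red) ⟩
    sumFin³ (λ i y z → ind (blue i y z)) + sumFin³ (λ i y z → ind (red i y z))
      ≡⟨ sumFin³-+ (λ i y z → ind (blue i y z)) (λ i y z → ind (red i y z)) ⟩
    sumFin³ (λ i y z → ind (blue i y z) + ind (red i y z))
      ≡⟨ sumFin³-cong _ _ (λ i y z → ind-split (hasD i y z) (bare i y z)) ⟩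
    sumFin³ (λ i y z → ind (bare i y z)) ∎
    where open ≡-Reasoning

  coloured-vertices≡D : bD + gD + yD + oD ≡ sumFin³ (λ a y z → ind (inD a y z))
  coloured-vertices≡D =
    trans (cong (λ s → s + gD + yD + oD) (count³-as-sumFin³ (inColour blue)))
   (trans (cong (λ s → s + yD + oD) (absorb _ (inColour green)))
   (trans (cong (_+ oD) (absorb _ (inColour yellow)))
   (trans (absorb _ (inColour orange))
          (sumFin³-cong _ _ (λ a y z →
             ind-split⁴ (inD a y z) (hasD (p a) y z) (hasY (p a) y z) (hasZ (p a) y z) D⇒hasD)))))
    where
    D⇒hasD : ∀ {a y z} → inD a y z ≡ true → hasD (p a) y z ≡ true
    D⇒hasD {a} {y} {z} a∈D =
      anyFin-intro _ a (trans (cong (_∧ inD a y z) (eqb-refl (p a))) a∈D)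
    inColour : (Fin k → V Y → V Z → Bool) → V X → V Y → V Z → Bool
    inColour col a y z = inD a y z ∧ col (p a) y z
    absorb : (f : V X → V Y → V Z → ℕ) (g : V X → V Y → V Z → Bool) →
      sumFin³ f + count³ g ≡ sumFin³ (λ a y z → f a y z + ind (g a y z))
    absorb f g = trans (cong (sumFin³ f +_) (count³-as-sumFin³ g)) (sumFin³-+ f _)

  module _ (u : Fin k → V X) (u-inj : Injective _≡_ _≡_ u)
           (u-minimum : IsMinimumDominatingSet X (image u))
           (covers : ∀ a → a ≡ u (p a) ⊎ adj X (u (p a)) a ≡ true)
           (dom : Dominating (X □ Y □ Z) D) where

    bare-cells≤fibre : ∀ y z → count (λ i → bare i y z) ≤ count (λ a → inD a y z)
    bare-cells≤fibre y z = +-cancelʳ-≤ (count nonbare) _ _ (begin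
      count (λ i → bare i y z) + count nonbare  ≡⟨ count-not (λ i → bare i y z) ⟩
      k                                         ≡⟨ ∣image∣ u u-inj ⟨
      ∣ image u ∣                               ≤⟨ proj₂ u-minimum T T-dominating ⟩
      ∣ T ∣                                     ≡⟨ ∣tabulate∣ (λ a → inD a y z ∨ centre a) ⟩
      count (λ a → inD a y z ∨ centre a)        ≤⟨ count-∨ (λ a → inD a y z) centre ⟩
      count (λ a → inD a y z) + count centre    ≡⟨ cong (count (λ a → inD a y z) +_) (count-image u u-inj nonbare) ⟩
      count (λ a → inD a y z) + count nonbare   ∎)
      where
      open ≤-Reasoning
      nonbare : Fin k → Bool
      nonbare i = not (bare i y z)
      centre : V X → Bool
      centre a = anyFin (λ i → nonbare i ∧ eqb (u i) a)
      T : Subset (n X)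
      T = tabulate (λ a → inD a y z ∨ centre a)
      centre∈T : ∀ a → bare (p a) y z ≡ false → u (p a) ∈ T
      centre∈T a nonbare-pa = ∈-tabulate⁺ _
        (trans (cong (inD (u (p a)) y z ∨_)
                     (anyFin-intro _ (p a) (cong₂ _∧_ (cong not nonbare-pa) (eqb-refl (u (p a))))))
               (∨-zeroʳ _))
      D∈T : ∀ {a} → inD a y z ≡ true → a ∈ T
      D∈T {a} a∈D = ∈-tabulate⁺ _ (cong (_∨ centre a) a∈D)
      T-dominating : Dominating X T
      T-dominating a with bare (p a) y z in bare-pa
      ... | false with covers a
      ...   | inj₁ a≡centre = inj₁ (subst (_∈ T) (sym a≡centre) (centre∈T a bare-pa))
      ...   | inj₂ centre~a = inj₂ (u (p a) , centre∈T a bare-pa , centre~a)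
      T-dominating a | true
        with fibre-dominated dom (proj₁ (bare⇒undominated bare-pa)) (proj₂ (bare⇒undominated bare-pa))
      ...   | inj₁ a∈D               = inj₁ (D∈T a∈D)
      ...   | inj₂ (a′ , a′∈D , a′~a) = inj₂ (a′ , D∈T a′∈D , a′~a)

    bare-cells≤D : sumFin³ (λ i y z → ind (bare i y z)) ≤ sumFin³ (λ a y z → ind (inD a y z))
    bare-cells≤D = begin
      sumFin³ (λ i y z → ind (bare i y z))
        ≡⟨ sumFin³-rotate (λ i y z → ind (bare i y z)) ⟩
      sumFin (λ y → sumFin (λ z → sumFin (λ i → ind (bare i y z))))
        ≤⟨ sumFin-mono _ _ (λ y → sumFin-mono _ _ (λ z →
             subst₂ _≤_ (count-as-sumFin (λ i → bare i y z)) (count-as-sumFin (λ a → inD a y z))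
                        (bare-cells≤fibre y z))) ⟩
      sumFin (λ y → sumFin (λ z → sumFin (λ a → ind (inD a y z))))
        ≡⟨ sumFin³-rotate (λ a y z → ind (inD a y z)) ⟨
      sumFin³ (λ a y z → ind (inD a y z)) ∎
      where open ≤-Reasoning

lemma3 : (X Y Z : Graph) → IsSimple X → IsSimple Y → IsSimple Z →
         (k : ℕ) (u : Fin k → V X) → Injective _≡_ _≡_ u →
         IsMinimumDominatingSet X (image u) →
         (p : V X → Fin k) →
         (∀ i → p (u i) ≡ i) →
         (∀ a → a ≡ u (p a) ⊎ adj X (u (p a)) a ≡ true) →
         (D : Subset (n (X □ Y □ Z))) →
         IsMinimumDominatingSet (X □ Y □ Z) D →
         Cells.b′ X Y Z p D + Cells.r′ X Y Z p D
           ≤ Cells.bD X Y Z p D + Cells.gD X Y Z p D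
             + Cells.yD X Y Z p D + Cells.oD X Y Z p D
lemma3 X Y Z _ _ _ k u u-inj u-minimum p _ covers D (dom , _) = begin
  b′ + r′                                        ≡⟨ blue+red≡bare X Y Z p D ⟩
  sumFin³ (λ i y z → ind (bare X Y Z p D i y z)) ≤⟨ bare-cells≤D X Y Z p D u u-inj u-minimum covers dom ⟩
  sumFin³ (λ a y z → ind (inD a y z))            ≡⟨ coloured-vertices≡D X Y Z p D ⟨
  bD + gD + yD + oD                              ∎
  where
  open ≤-Reasoning
  open Cells X Y Z p D
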